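{- Let $n\ge 2$ and $x^\Lambda\partial_k\in\mathcal{B}$. Then $\mathrm{WD}(x^\Lambda\partial_k)\ge n-k$, with equality if and only if $x^\Lambda\partial_k=x_1^{\lambda_1}\partial_k$ (i.e. $\lambda_t=0$ for all $t\ge 2$). Moreover, if $\mathrm{lev}_i(x^\Lambda\partial_k)\le i$ for some integer $i\ge -1$, then $\mathrm{WD}(x^\Lambda\partial_k)\le n-1$, and $\mathrm{WD}(x^\Lambda\partial_k)=n-1$ if and only if $x^\Lambda\partial_k=\partial_1$.
   Context: Let $n\ge 2$ be an integer. A partition is a sequence $\Lambda=(\lambda_t)_{t\ge 1}$ of non-negative integers with finite support; $\mathrm{wt}(\Lambda)=\sum_t t\lambda_t$; $x^\Lambda=\prod_t x_t^{\lambda_t}$ (monomial in commuting indeterminates), $\deg(x^\Lambda)=\sum_t\lambda_t$. $\mathrm{Part}(j)$ is the set of partitions with $\lambda_t=0$ for $t>j$; $\partial_k$ is the partial derivative with respect to $x_k$. Let $\mathcal{B}=\{x^\Lambda\partial_k:1\le k\le n,\ \Lambda\in\mathrm{Part}(k-1)\}$. For an integer $i\ge -1$ let $r_i\in\{1,\dots,n-1\}$ with $i\equiv r_i\pmod{n-1}$ and $h_i=\lfloor (i-1)/(n-1)\rfloor+1$, so $i=(h_i-1)(n-1)+r_i$. For $x^\Lambda\partial_k\in\mathcal{B}$ define $\mathrm{WD}(x^\Lambda\partial_k)=\mathrm{wt}(\Lambda)-\deg(x^\Lambda)+n-k$ and $\mathrm{lev}_i(x^\Lambda\partial_k)=h_i\,\mathrm{WD}(x^\Lambda\partial_k)+\deg(x^\Lambda)-1$.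 -}

module Defs where

open import Data.Nat as ℕ using (ℕ; zero; suc; _∸_)
open import Data.Integer as ℤ using (ℤ; +_; _-_; _*_; _+_)
open import Data.Integer.DivMod using (_/_)
open import Data.Vec using (Vec; []; _∷_)
open import Data.Vec.Relation.Unary.All using (All)
open import Data.Unit using (⊤)
open import Relation.Binary.PropositionalEquality using (_≡_)

-- A partition Λ ∈ Part(j) is represented by the vector (λ₁, …, λⱼ) : Vec ℕ j
-- (all λ_t with t > j are zero).  An element x^Λ ∂_k of 𝓑 (1 ≤ k ≤ n) is given
-- by k together with Λ : Vec ℕ (k ∸ 1).

wtFrom : ∀ {m} → ℕ → Vec ℕ m → ℕ
wtFrom s []       = 0
wtFrom s (x ∷ xs) = s ℕ.* x ℕ.+ wtFrom (suc s) xs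

-- wt(Λ) = Σ_t t λ_t
wt : ∀ {m} → Vec ℕ m → ℕ
wt = wtFrom 1

deg : ∀ {m} → Vec ℕ m → ℕ
deg []       = 0
deg (x ∷ xs) = x ℕ.+ deg xs

WD : (n k : ℕ) → Vec ℕ (k ∸ 1) → ℤ
WD n k Λ = ((+ wt Λ) - (+ deg Λ)) + (+ n) - (+ k)

-- h_i = ⌊(i-1)/(n-1)⌋ + 1   (only meaningful for n ≥ 2; junk value 0 otherwise)
hI : ℕ → ℤ → ℤ
hI (suc (suc m)) i = ((i - + 1) / (+ suc m)) + + 1
hI _             i = + 0

lev : (n : ℕ) → ℤ → (k : ℕ) → Vec ℕ (k ∸ 1) → ℤ
lev n i k Λ = (hI n i * WD n k Λ) + (+ deg Λ) - + 1

OnlyX1 : ∀ {m} → Vec ℕ m → Set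
OnlyX1 []       = ⊤
OnlyX1 (x ∷ xs) = All (_≡ 0) xs

module Submission where

open import Defs
open import Data.Nat using (ℕ; _∸_)
open import Data.Integer using (ℤ; +_; -[1+_]; _≤_)
open import Data.Vec using (Vec)
open import Data.Vec.Relation.Unary.All using (All)
open import Data.Product using (_×_)
open import Function.Bundles using (_⇔_)
open import Relation.Binary.PropositionalEquality using (_≡_)

open import Data.Nat as ℕ using (zero; suc; z≤n; s≤s; z<s)
import Data.Nat.Properties as ℕ
import Data.Integer as ℤ
import Data.Integer.Properties as ℤ
open import Data.Integer.DivMod using (div-pos-is-/ℕ; n<s[n/ℕd]*d)
open import Data.Vec using ([]; _∷_)
open import Data.Vec.Relation.Unary.All using ([]; _∷_)
open import Data.Product using (∃-syntax; _,_)
open import Data.Sum using (_⊎_; inj₁; inj₂)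
open import Function.Bundles using (mk⇔; module Equivalence)
open import Relation.Nullary using (contradiction)
open import Relation.Binary.PropositionalEquality using (refl; sym; cong; cong₂; subst; subst₂; module ≡-Reasoning)
import Data.Nat.Tactic.RingSolver as ℕ-Ring
import Data.Integer.Tactic.RingSolver as ℤ-Ring

-- Write E = wt Λ - deg Λ = Σ (t - 1) λ_t, so that WD = E + (n - k); the first two claims are
-- then immediate.  Since t - 1 ≤ k - 2 on the support, E ≤ (k - 2) deg Λ.  If lev_i ≤ i, then
-- h_i WD + deg Λ - 1 ≤ i ≤ h_i (n - 1), as h_i is the least h with i ≤ h (n - 1).  For deg Λ ≥ 2
-- and h_i ≥ 0 this forces WD < n - 1; for deg Λ ≤ 1 the bound on E gives E = 0 or E < k - 1.
-- Either way WD ≤ n - 1, with equality only if E = 0 and k = 1.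

excess : ∀ {m} → Vec ℕ m → ℕ
excess = wtFrom 0

wtFrom-suc : ∀ {m} s (xs : Vec ℕ m) → wtFrom (suc s) xs ≡ deg xs ℕ.+ wtFrom s xs
wtFrom-suc s []       = refl
wtFrom-suc s (x ∷ xs) rewrite wtFrom-suc (suc s) xs = shuffle x (s ℕ.* x) (deg xs) (wtFrom (suc s) xs)
  where
  shuffle : ∀ a b c d → (a ℕ.+ b) ℕ.+ (c ℕ.+ d) ≡ (a ℕ.+ c) ℕ.+ (b ℕ.+ d)
  shuffle = ℕ-Ring.solve-∀

wt≡deg+excess : ∀ {m} (xs : Vec ℕ m) → wt xs ≡ deg xs ℕ.+ excess xs
wt≡deg+excess = wtFrom-suc 0

All≡0⇒wtFrom≡0 : ∀ {m} s {xs : Vec ℕ m} → All (_≡ 0) xs → wtFrom s xs ≡ 0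
All≡0⇒wtFrom≡0 s []                              = refl
All≡0⇒wtFrom≡0 s (refl ∷ ps) rewrite ℕ.*-zeroʳ s = All≡0⇒wtFrom≡0 (suc s) ps

wtFrom-suc≡0⇒All≡0 : ∀ {m} s (xs : Vec ℕ m) → wtFrom (suc s) xs ≡ 0 → All (_≡ 0) xs
wtFrom-suc≡0⇒All≡0 s []       _  = []
wtFrom-suc≡0⇒All≡0 s (x ∷ xs) eq =
  ℕ.m+n≡0⇒m≡0 x (ℕ.m+n≡0⇒m≡0 _ eq) ∷ wtFrom-suc≡0⇒All≡0 (suc s) xs (ℕ.m+n≡0⇒n≡0 (x ℕ.+ s ℕ.* x) eq)

excess≡0⇔OnlyX1 : ∀ {m} (xs : Vec ℕ m) → excess xs ≡ 0 ⇔ OnlyX1 xs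
excess≡0⇔OnlyX1 []       = mk⇔ _ (λ _ → refl)
excess≡0⇔OnlyX1 (x ∷ xs) = mk⇔ (wtFrom-suc≡0⇒All≡0 0 xs) (All≡0⇒wtFrom≡0 1)

wtFrom+deg≤*deg : ∀ {m} s (xs : Vec ℕ m) → wtFrom s xs ℕ.+ deg xs ℕ.≤ (s ℕ.+ m) ℕ.* deg xs
wtFrom+deg≤*deg s [] = z≤n
wtFrom+deg≤*deg {suc m} s (x ∷ xs) = begin
  (s ℕ.* x ℕ.+ wtFrom (suc s) xs) ℕ.+ (x ℕ.+ deg xs)        ≡⟨ regroup s x (wtFrom (suc s) xs) (deg xs) ⟩
  (s ℕ.* x ℕ.+ x) ℕ.+ (wtFrom (suc s) xs ℕ.+ deg xs)        ≤⟨ ℕ.+-mono-≤ (ℕ.m≤m+n (s ℕ.* x ℕ.+ x) (m ℕ.* x)) (wtFrom+deg≤*deg (suc s) xs) ⟩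
  (s ℕ.* x ℕ.+ x ℕ.+ m ℕ.* x) ℕ.+ (suc s ℕ.+ m) ℕ.* deg xs  ≡⟨ expand s m x (deg xs) ⟨
  (s ℕ.+ suc m) ℕ.* (x ℕ.+ deg xs)                          ∎
  where
  open ℕ.≤-Reasoning
  regroup : ∀ s x w d → (s ℕ.* x ℕ.+ w) ℕ.+ (x ℕ.+ d) ≡ (s ℕ.* x ℕ.+ x) ℕ.+ (w ℕ.+ d)
  regroup = ℕ-Ring.solve-∀
  expand : ∀ s m x d → (s ℕ.+ suc m) ℕ.* (x ℕ.+ d) ≡ (s ℕ.* x ℕ.+ x ℕ.+ m ℕ.* x) ℕ.+ (suc s ℕ.+ m) ℕ.* d
  expand = ℕ-Ring.solve-∀

excess+deg≤length*deg : ∀ {m} (xs : Vec ℕ m) → excess xs ℕ.+ deg xs ℕ.≤ m ℕ.* deg xs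
excess+deg≤length*deg = wtFrom+deg≤*deg 0

excess-short : ∀ {m} (xs : Vec ℕ m) → m ℕ.≤ 1 → excess xs ≡ 0
excess-short []          _        = refl
excess-short (_ ∷ [])    _        = refl
excess-short (_ ∷ _ ∷ _) (s≤s ())

WD≡+excess : ∀ n k (Λ : Vec ℕ (k ∸ 1)) → k ℕ.≤ n → WD n k Λ ≡ + (excess Λ ℕ.+ (n ∸ k))
WD≡+excess n k Λ k≤n = begin
  + wt Λ ℤ.- + deg Λ ℤ.+ + n ℤ.- + k              ≡⟨ cong (λ w → w ℤ.- + deg Λ ℤ.+ + n ℤ.- + k) (cong +_ (wt≡deg+excess Λ)) ⟩
  + (deg Λ ℕ.+ excess Λ) ℤ.- + deg Λ ℤ.+ + n ℤ.- + k ≡⟨ cong (λ w → w ℤ.- + deg Λ ℤ.+ + n ℤ.- + k) (ℤ.pos-+ (deg Λ) (excess Λ)) ⟩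
  + deg Λ ℤ.+ + excess Λ ℤ.- + deg Λ ℤ.+ + n ℤ.- + k ≡⟨ cancel (+ deg Λ) (+ excess Λ) (+ n) (+ k) ⟩
  + excess Λ ℤ.+ (+ n ℤ.- + k)                     ≡⟨ cong (ℤ._+_ (+ excess Λ)) (ℤ.m-n≡m⊖n n k) ⟩
  + excess Λ ℤ.+ (n ℤ.⊖ k)                         ≡⟨ cong (ℤ._+_ (+ excess Λ)) (ℤ.⊖-≥ k≤n) ⟩
  + excess Λ ℤ.+ + (n ∸ k)                         ≡⟨ ℤ.pos-+ (excess Λ) (n ∸ k) ⟨
  + (excess Λ ℕ.+ (n ∸ k))                         ∎
  where
  open ≡-Reasoning
  cancel : ∀ d e n k → d ℤ.+ e ℤ.- d ℤ.+ n ℤ.- k ≡ e ℤ.+ (n ℤ.- k)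
  cancel = ℤ-Ring.solve-∀

i≤hI*[n∸1] : ∀ m i → i ≤ hI (suc (suc m)) i ℤ.* + suc m
i≤hI*[n∸1] m i = begin
  i                                  ≡⟨ i≡suc[i-1] i ⟩
  ℤ.suc (i ℤ.- + 1)                  ≤⟨ ℤ.i<j⇒suc[i]≤j (n<s[n/ℕd]*d (i ℤ.- + 1) (suc m)) ⟩
  ℤ.suc q ℤ.* + suc m                ≡⟨ cong (ℤ._* + suc m) (ℤ.+-comm (+ 1) q) ⟩
  (q ℤ.+ + 1) ℤ.* + suc m            ≡⟨ cong (λ x → (x ℤ.+ + 1) ℤ.* + suc m) (div-pos-is-/ℕ (i ℤ.- + 1) (suc m)) ⟨
  hI (suc (suc m)) i ℤ.* + suc m     ∎
  where
  open ℤ.≤-Reasoning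
  q : ℤ
  q = (i ℤ.- + 1) ℤ./ℕ suc m
  i≡suc[i-1] : ∀ i → i ≡ + 1 ℤ.+ (i ℤ.- + 1)
  i≡suc[i-1] = ℤ-Ring.solve-∀

-- Fails for n = 2, where h₋₁ = -1; there Λ has at most one entry and E = 0 anyway.
hI-natural : ∀ m i → -[1+ 0 ] ≤ i → ∃[ q ] hI (suc (suc (suc m))) i ≡ + q
hI-natural zero    -[1+ 0 ]     _          = 0 , refl
hI-natural (suc m) -[1+ 0 ]     _          = 0 , refl
hI-natural m       -[1+ suc _ ] (ℤ.-≤- ())
hI-natural m       (+ 0)        _          = 0 , refl
hI-natural m       (+ suc j)    _          =
  j ℕ./ suc (suc m) ℕ.+ 1 , cong (ℤ._+ + 1) (div-pos-is-/ℕ (+ j) (suc (suc m)))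

m-1≤n⇒m≤1+n : ∀ {m n} → + m ℤ.- + 1 ≤ + n → m ℕ.≤ suc n
m-1≤n⇒m≤1+n {zero}  _   = z≤n
m-1≤n⇒m≤1+n {suc m} m≤n = s≤s (ℤ.drop‿+≤+ m≤n)

excess-dichotomy : ∀ {L} (Λ : Vec ℕ L) q r →
  q ℕ.* (excess Λ ℕ.+ r) ℕ.+ deg Λ ℕ.≤ suc (q ℕ.* (L ℕ.+ r)) → excess Λ ≡ 0 ⊎ excess Λ ℕ.< L
excess-dichotomy {L} Λ q r lev≤ with deg Λ | excess+deg≤length*deg Λ
... | 0           | bound = inj₁ (ℕ.n≤0⇒n≡0 (subst₂ ℕ._≤_ (ℕ.+-identityʳ (excess Λ)) (ℕ.*-zeroʳ L) bound))
... | 1           | bound = inj₂ (subst₂ ℕ._≤_ (ℕ.+-comm (excess Λ) 1) (ℕ.*-identityʳ L) bound)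
... | suc (suc d) | _     = inj₂ (ℕ.+-cancelʳ-< r (excess Λ) L (ℕ.*-cancelˡ-< q _ _ (ℕ.≤-pred lhs<)))
  where
  open ℕ.≤-Reasoning
  lhs< : suc (suc (q ℕ.* (excess Λ ℕ.+ r))) ℕ.≤ suc (q ℕ.* (L ℕ.+ r))
  lhs< = begin
    suc (suc (q ℕ.* (excess Λ ℕ.+ r)))     ≡⟨ ℕ.+-comm 2 _ ⟩
    q ℕ.* (excess Λ ℕ.+ r) ℕ.+ 2           ≤⟨ ℕ.+-monoʳ-≤ _ (ℕ.m≤m+n 2 d) ⟩
    q ℕ.* (excess Λ ℕ.+ r) ℕ.+ (2 ℕ.+ d)   ≤⟨ lev≤ ⟩
    suc (q ℕ.* (L ℕ.+ r))                  ∎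

lev≤⇒excess-dichotomy : ∀ m {L} (Λ : Vec ℕ L) i → L ℕ.≤ suc m → -[1+ 0 ] ≤ i →
  lev (suc (suc m)) i (suc L) Λ ≤ i → excess Λ ≡ 0 ⊎ excess Λ ℕ.< L
lev≤⇒excess-dichotomy zero        Λ i L≤1 _    _     = inj₁ (excess-short Λ L≤1)
lev≤⇒excess-dichotomy (suc m) {L} Λ i L≤n -1≤i lev≤i with hI-natural m i -1≤i
... | q , hI≡q =
  excess-dichotomy Λ q r (subst (λ N → q ℕ.* W ℕ.+ deg Λ ℕ.≤ suc (q ℕ.* N)) (sym (ℕ.m+[n∸m]≡n L≤n))
                                (m-1≤n⇒m≤1+n lev-bound))
  where
  n r W : ℕ
  n = suc (suc (suc m))
  r = suc (suc m) ∸ L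
  W = excess Λ ℕ.+ r
  open ℤ.≤-Reasoning
  lev-bound : + (q ℕ.* W ℕ.+ deg Λ) ℤ.- + 1 ≤ + (q ℕ.* suc (suc m))
  lev-bound = begin
    + (q ℕ.* W ℕ.+ deg Λ) ℤ.- + 1      ≡⟨ cong (ℤ._- + 1) (ℤ.pos-+ (q ℕ.* W) (deg Λ)) ⟩
    + (q ℕ.* W) ℤ.+ + deg Λ ℤ.- + 1    ≡⟨ cong (λ x → x ℤ.+ + deg Λ ℤ.- + 1) (ℤ.pos-* q W) ⟩
    + q ℤ.* + W ℤ.+ + deg Λ ℤ.- + 1    ≡⟨ cong₂ (λ h w → h ℤ.* w ℤ.+ + deg Λ ℤ.- + 1) hI≡q (WD≡+excess n (suc L) Λ (s≤s L≤n)) ⟨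
    lev n i (suc L) Λ                  ≤⟨ lev≤i ⟩
    i                                  ≤⟨ i≤hI*[n∸1] (suc m) i ⟩
    hI n i ℤ.* + suc (suc m)           ≡⟨ cong (ℤ._* + suc (suc m)) hI≡q ⟩
    + q ℤ.* + suc (suc m)              ≡⟨ ℤ.pos-* q (suc (suc m)) ⟨
    + (q ℕ.* suc (suc m))              ∎

excess-dichotomy⇒WD-top : ∀ n {L} (Λ : Vec ℕ L) → L ℕ.≤ n → excess Λ ≡ 0 ⊎ excess Λ ℕ.< L →
  (+ (excess Λ ℕ.+ (n ∸ L)) ≤ + n) × (+ (excess Λ ℕ.+ (n ∸ L)) ≡ + n ⇔ (suc L ≡ 1 × All (_≡ 0) Λ))
excess-dichotomy⇒WD-top n []           _   _         = ℤ.≤-refl , mk⇔ (λ _ → refl , []) (λ _ → refl)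
excess-dichotomy⇒WD-top n {suc L} Λ@(_ ∷ _) L≤n dichotomy =
  ℤ.+≤+ (ℕ.<⇒≤ W<n) , mk⇔ (λ W≡n → contradiction (ℤ.+-injective W≡n) (ℕ.<⇒≢ W<n)) λ { (() , _) }
  where
  open ℕ.≤-Reasoning
  below : excess Λ ≡ 0 ⊎ excess Λ ℕ.< suc L → excess Λ ℕ.+ (n ∸ suc L) ℕ.< n
  below (inj₁ e≡0) rewrite e≡0 = ℕ.∸-monoʳ-< z<s L≤n
  below (inj₂ e<L) = begin-strict
    excess Λ ℕ.+ (n ∸ suc L)  <⟨ ℕ.+-monoˡ-< (n ∸ suc L) e<L ⟩
    suc L ℕ.+ (n ∸ suc L)     ≡⟨ ℕ.m+[n∸m]≡n L≤n ⟩
    n                         ∎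
  W<n : excess Λ ℕ.+ (n ∸ suc L) ℕ.< n
  W<n = below dichotomy

lemma2p2 : (n : ℕ) → 2 Data.Nat.≤ n → (k : ℕ) → 1 Data.Nat.≤ k → k Data.Nat.≤ n → (Λ : Vec ℕ (k ∸ 1)) →
    (+ (n ∸ k) ≤ WD n k Λ)
    × (WD n k Λ ≡ + (n ∸ k) ⇔ OnlyX1 Λ)
    × ((i : ℤ) → -[1+ 0 ] ≤ i → lev n i k Λ ≤ i →
        (WD n k Λ ≤ + (n ∸ 1))
        × (WD n k Λ ≡ + (n ∸ 1) ⇔ (k ≡ 1 × All (_≡ 0) Λ)))
lemma2p2 (suc (suc m)) (s≤s (s≤s z≤n)) (suc L) (s≤s z≤n) k≤n@(s≤s L≤n) Λ =
    subst (+ r ≤_) (sym WD≡W) (ℤ.+≤+ (ℕ.m≤n+m r (excess Λ)))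
  , subst (λ w → w ≡ + r ⇔ OnlyX1 Λ) (sym WD≡W)
      (mk⇔ (λ W≡r → to (ℕ.+-cancelʳ-≡ r (excess Λ) 0 (ℤ.+-injective W≡r)))
           (λ only → cong (λ e → + (e ℕ.+ r)) (from only)))
  , λ i -1≤i lev≤i → subst (λ w → (w ≤ + suc m) × (w ≡ + suc m ⇔ (suc L ≡ 1 × All (_≡ 0) Λ))) (sym WD≡W)
      (excess-dichotomy⇒WD-top (suc m) Λ L≤n (lev≤⇒excess-dichotomy m Λ i L≤n -1≤i lev≤i))
  where
  r : ℕ
  r = suc m ∸ L
  WD≡W : WD (suc (suc m)) (suc L) Λ ≡ + (excess Λ ℕ.+ r)
  WD≡W = WD≡+excess (suc (suc m)) (suc L) Λ k≤n
  open Equivalence (excess≡0⇔OnlyX1 Λ)
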